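{- The logic $\mathbf{IL}^-(\mathbf{J2},\mathbf{J4}_+,\mathbf{J5})$ does not prove the schema $\mathbf{J2}_+$; that is, some instance $(A\rhd(B\lor C))\land(B\rhd C)\to A\rhd C$ is not a theorem of $\mathbf{IL}^-(\mathbf{J2},\mathbf{J4}_+,\mathbf{J5})$.
   Context: Formulas are built from countably many propositional variables, $\top,\bot$, $\neg,\land,\lor,\to$, unary $\Box$ and binary $\rhd$; $\Diamond A$ abbreviates $\neg\Box\neg A$. The logic $\mathbf{IL}^-$ has as axioms all tautologies, $\Box(A\to B)\to(\Box A\to\Box B)$, $\Box(\Box A\to A)\to\Box A$, $(A\rhd C)\land(B\rhd C)\to(A\lor B)\rhd C$, and $\Box A\leftrightarrow(\neg A)\rhd\bot$; rules: modus ponens, necessitation, from $A\to B$ infer $C\rhd A\to C\rhd B$, from $A\to B$ infer $B\rhd C\to A\rhd C$. $\mathbf{IL}^-(\Sigma_1,\dots,\Sigma_n)$ is $\mathbf{IL}^-$ with schemata $\Sigma_i$ added as axioms. Schemata: $\mathbf{J2}$: $(A\rhd B)\land(B\rhd C)\to A\rhd C$; $\mathbf{J2}_+$: $(A\rhd(B\lor C))\land(B\rhd C)\to A\rhd C$; $\mathbf{J4}_+$: $\Box(A\to B)\to(C\rhd A\to C\rhd B)$; $\mathbf{J5}$: $\Diamond A\rhd A$. -}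

module Defs where

open import Data.Nat using (ℕ)
open import Data.Bool using (Bool; true; false; not; _∧_; _∨_)

infixr 6 _⊃_
infixr 7 _∨'_
infixr 8 _∧'_
infix 9 _▷_

data Formula : Set where
  var  : ℕ → Formula
  ⊤'   : Formula
  ⊥'   : Formula
  ¬'_  : Formula → Formula
  _∧'_ : Formula → Formula → Formula
  _∨'_ : Formula → Formula → Formula
  _⊃_  : Formula → Formula → Formula
  □_   : Formula → Formula
  _▷_  : Formula → Formula → Formula

◇_ : Formula → Formula
◇ A = ¬' (□ (¬' A))

_⇔_ : Formula → Formula → Formula
A ⇔ B = (A ⊃ B) ∧' (B ⊃ A)

_⇒ᵇ_ : Bool → Bool → Bool
a ⇒ᵇ b = not a ∨ b

-- Propositional valuation: modal subformulas (□A, A ▷ B) and variables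
-- are treated as propositional atoms, with arbitrary truth values.
record Valuation : Set where
  field
    atom : ℕ → Bool
    box  : Formula → Bool
    rhd  : Formula → Formula → Bool

eval : Valuation → Formula → Bool
eval v (var n)  = Valuation.atom v n
eval v ⊤'       = true
eval v ⊥'       = false
eval v (¬' A)   = not (eval v A)
eval v (A ∧' B) = eval v A ∧ eval v B
eval v (A ∨' B) = eval v A ∨ eval v B
eval v (A ⊃ B)  = eval v A ⇒ᵇ eval v B
eval v (□ A)    = Valuation.box v A
eval v (A ▷ B)  = Valuation.rhd v A B

-- A (substitution instance of a propositional) tautology
Tautology : Formula → Set
Tautology A = (v : Valuation) → eval v A ≡ true
  where open import Relation.Binary.PropositionalEquality using (_≡_)

J2 : Formula → Formula → Formula → Formula
J2 A B C = ((A ▷ B) ∧' (B ▷ C)) ⊃ (A ▷ C)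

J2₊ : Formula → Formula → Formula → Formula
J2₊ A B C = ((A ▷ (B ∨' C)) ∧' (B ▷ C)) ⊃ (A ▷ C)

J4₊ : Formula → Formula → Formula → Formula
J4₊ A B C = (□ (A ⊃ B)) ⊃ ((C ▷ A) ⊃ (C ▷ B))

J5 : Formula → Formula
J5 A = (◇ A) ▷ A

data ⊢ : Formula → Set where
  taut  : ∀ {A} → Tautology A → ⊢ A
  axK   : ∀ A B → ⊢ (□ (A ⊃ B) ⊃ (□ A ⊃ □ B))
  axL   : ∀ A → ⊢ (□ (□ A ⊃ A) ⊃ □ A)
  axJ3  : ∀ A B C → ⊢ (((A ▷ C) ∧' (B ▷ C)) ⊃ ((A ∨' B) ▷ C))
  axJ6  : ∀ A → ⊢ ((□ A) ⇔ ((¬' A) ▷ ⊥'))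
  axJ2  : ∀ A B C → ⊢ (J2 A B C)
  axJ4₊ : ∀ A B C → ⊢ (J4₊ A B C)
  axJ5  : ∀ A → ⊢ (J5 A)
  mp    : ∀ {A B} → ⊢ (A ⊃ B) → ⊢ A → ⊢ B
  nec   : ∀ {A} → ⊢ A → ⊢ (□ A)
  r1    : ∀ {A B} C → ⊢ (A ⊃ B) → ⊢ ((C ▷ A) ⊃ (C ▷ B))
  r2    : ∀ {A B} C → ⊢ (A ⊃ B) → ⊢ ((B ▷ C) ⊃ (A ▷ C))

module Submission where

-- We exhibit a model of IL⁻(J2, J4₊, J5) refuting an instance of
-- J2₊.  It has a root with three successors x, y, z, all of them endpoints.
-- At the root, □A holds iff A holds at x, y and z, and A ▷ B holds iff
--   x ⊨ A implies y ⊨ B and z ⊨ B,   y ⊨ A implies z ⊨ B,   and z ⊭ A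
-- (x "sees" the set {y, z}, y sees {z}, and z sees no set at all, as in a
-- generalised Veltman frame); at the endpoints every □- and ▷-formula is true.
-- At the root, a modal formula depends only on the TRACE of its arguments,
-- i.e. their truth values at x, y, z; so soundness of each axiom and rule at
-- the root reduces to a Boolean identity about traces, checked exhaustively.  Finally,
-- with p, q, r true exactly at x, y, z respectively, the instance
-- (p ▷ (q ∨ r)) ∧ (q ▷ r) → p ▷ r of J2₊ fails at the root.

open import Defs
open import Data.Bool using (Bool; true; false; not; _∧_; _∨_)
open import Data.Bool.Properties using (∧-conicalˡ; ∧-conicalʳ)
open import Data.Nat using (ℕ)
open import Data.Product using (_,_; ∃-syntax)
open import Relation.Nullary using (¬_)
open import Relation.Binary.PropositionalEquality using (_≡_; refl; sym; trans; cong; cong₂)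

mpᵇ : ∀ {a b} → (a ⇒ᵇ b) ≡ true → a ≡ true → b ≡ true
mpᵇ {true} a⇒b refl = a⇒b

-- Traces: the truth values of a formula at the three successors x, y, z.

data Trace : Set where
  ⟨_,_,_⟩ : Bool → Bool → Bool → Trace

_⇒ᵗ_ _∨ᵗ_ : Trace → Trace → Trace
⟨ a₁ , a₂ , a₃ ⟩ ⇒ᵗ ⟨ b₁ , b₂ , b₃ ⟩ = ⟨ a₁ ⇒ᵇ b₁ , a₂ ⇒ᵇ b₂ , a₃ ⇒ᵇ b₃ ⟩
⟨ a₁ , a₂ , a₃ ⟩ ∨ᵗ ⟨ b₁ , b₂ , b₃ ⟩ = ⟨ a₁ ∨ b₁ , a₂ ∨ b₂ , a₃ ∨ b₃ ⟩

¬ᵗ_ : Trace → Trace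
¬ᵗ ⟨ a₁ , a₂ , a₃ ⟩ = ⟨ not a₁ , not a₂ , not a₃ ⟩

⊤ᵗ ⊥ᵗ : Trace
⊤ᵗ = ⟨ true , true , true ⟩
⊥ᵗ = ⟨ false , false , false ⟩

□ᵗ : Trace → Bool
□ᵗ ⟨ a₁ , a₂ , a₃ ⟩ = a₁ ∧ a₂ ∧ a₃

_▷ᵗ_ : Trace → Trace → Bool
⟨ a₁ , a₂ , a₃ ⟩ ▷ᵗ ⟨ b₁ , b₂ , b₃ ⟩ = (a₁ ⇒ᵇ (b₂ ∧ b₃)) ∧ (a₂ ⇒ᵇ b₃) ∧ not a₃

everyᵇ : (Bool → Bool) → Bool
everyᵇ g = g true ∧ g false

everyᵇ-sound : (g : Bool → Bool) → everyᵇ g ≡ true → ∀ b → g b ≡ true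
everyᵇ-sound g ok true  = ∧-conicalˡ (g true) (g false) ok
everyᵇ-sound g ok false = ∧-conicalʳ (g true) (g false) ok

every : (Trace → Bool) → Bool
every f = everyᵇ λ a₁ → everyᵇ λ a₂ → everyᵇ λ a₃ → f ⟨ a₁ , a₂ , a₃ ⟩

every-sound : (f : Trace → Bool) → every f ≡ true → ∀ t → f t ≡ true
every-sound f ok ⟨ a₁ , a₂ , a₃ ⟩ =
  everyᵇ-sound (λ a₃ → f ⟨ a₁ , a₂ , a₃ ⟩)
    (everyᵇ-sound (λ a₂ → everyᵇ λ a₃ → f ⟨ a₁ , a₂ , a₃ ⟩)
      (everyᵇ-sound (λ a₁ → everyᵇ λ a₂ → everyᵇ λ a₃ → f ⟨ a₁ , a₂ , a₃ ⟩) ok a₁) a₂) a₃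

-- A property of one, two or three traces holds if it holds in all 8, 64 or
-- 512 cases; the property is inferred from the goal.
by-cases₁ : {f : Trace → Bool} → every f ≡ true → ∀ a → f a ≡ true
by-cases₁ {f} = every-sound f

by-cases₂ : {f : Trace → Trace → Bool} →
            every (λ a → every (f a)) ≡ true → ∀ a b → f a b ≡ true
by-cases₂ {f} ok a = every-sound (f a) (every-sound (λ a → every (f a)) ok a)

by-cases₃ : {f : Trace → Trace → Trace → Bool} →
            every (λ a → every λ b → every (f a b)) ≡ true →
            ∀ a b c → f a b c ≡ true
by-cases₃ {f} ok a b = every-sound (f a b) (by-cases₂ {λ a b → every (f a b)} ok a b)

□ᵗ-K : ∀ a b → (□ᵗ (a ⇒ᵗ b) ⇒ᵇ (□ᵗ a ⇒ᵇ □ᵗ b)) ≡ true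
□ᵗ-K = by-cases₂ refl

-- Löb's axiom: the trace of □A is ⊤ᵗ because the successors are endpoints.
□ᵗ-Löb : ∀ a → (□ᵗ (⊤ᵗ ⇒ᵗ a) ⇒ᵇ □ᵗ a) ≡ true
□ᵗ-Löb = by-cases₁ refl

▷ᵗ-J3 : ∀ a b c → ((a ▷ᵗ c ∧ b ▷ᵗ c) ⇒ᵇ ((a ∨ᵗ b) ▷ᵗ c)) ≡ true
▷ᵗ-J3 = by-cases₃ refl

□ᵗ-J6 : ∀ a → ((□ᵗ a ⇒ᵇ ((¬ᵗ a) ▷ᵗ ⊥ᵗ)) ∧ (((¬ᵗ a) ▷ᵗ ⊥ᵗ) ⇒ᵇ □ᵗ a)) ≡ true
□ᵗ-J6 = by-cases₁ refl

▷ᵗ-J2 : ∀ a b c → ((a ▷ᵗ b ∧ b ▷ᵗ c) ⇒ᵇ (a ▷ᵗ c)) ≡ true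
▷ᵗ-J2 = by-cases₃ refl

▷ᵗ-J4₊ : ∀ a b c → (□ᵗ (a ⇒ᵗ b) ⇒ᵇ ((c ▷ᵗ a) ⇒ᵇ (c ▷ᵗ b))) ≡ true
▷ᵗ-J4₊ = by-cases₃ refl

▷ᵗ-antitone : ∀ a b c → (□ᵗ (a ⇒ᵗ b) ⇒ᵇ ((b ▷ᵗ c) ⇒ᵇ (a ▷ᵗ c))) ≡ true
▷ᵗ-antitone = by-cases₃ refl

data Leaf : Set where
  x y z : Leaf

data World : Set where
  root : World
  leaf : Leaf → World

atom : World → ℕ → Bool
atom (leaf x) 0 = true
atom (leaf y) 1 = true
atom (leaf z) 2 = true
atom _        _ = false

mutual
  sat : World → Formula → Bool
  sat u (var n)         = atom u n
  sat u ⊤'              = true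
  sat u ⊥'              = false
  sat u (¬' A)          = not (sat u A)
  sat u (A ∧' B)        = sat u A ∧ sat u B
  sat u (A ∨' B)        = sat u A ∨ sat u B
  sat u (A ⊃ B)         = sat u A ⇒ᵇ sat u B
  sat root (□ A)        = □ᵗ (trace A)
  sat root (A ▷ B)      = trace A ▷ᵗ trace B
  sat (leaf _) (□ A)    = true
  sat (leaf _) (A ▷ B)  = true

  trace : Formula → Trace
  trace A = ⟨ sat (leaf x) A , sat (leaf y) A , sat (leaf z) A ⟩

Valid : Formula → Set
Valid A = ∀ u → sat u A ≡ true

valuation : World → Valuation
valuation u = record { atom = atom u ; box = λ A → sat u (□ A) ; rhd = λ A B → sat u (A ▷ B) }

eval-valuation : ∀ u A → eval (valuation u) A ≡ sat u A
eval-valuation u (var n)  = refl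
eval-valuation u ⊤'       = refl
eval-valuation u ⊥'       = refl
eval-valuation u (¬' A)   = cong not (eval-valuation u A)
eval-valuation u (A ∧' B) = cong₂ _∧_ (eval-valuation u A) (eval-valuation u B)
eval-valuation u (A ∨' B) = cong₂ _∨_ (eval-valuation u A) (eval-valuation u B)
eval-valuation u (A ⊃ B)  = cong₂ _⇒ᵇ_ (eval-valuation u A) (eval-valuation u B)
eval-valuation u (□ A)    = refl
eval-valuation u (A ▷ B)  = refl

tautology-valid : ∀ {A} → Tautology A → Valid A
tautology-valid {A} t u = trans (sym (eval-valuation u A)) (t (valuation u))

K-valid : ∀ A B → Valid (□ (A ⊃ B) ⊃ (□ A ⊃ □ B))
K-valid A B root     = □ᵗ-K (trace A) (trace B)
K-valid A B (leaf _) = refl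

Löb-valid : ∀ A → Valid (□ (□ A ⊃ A) ⊃ □ A)
Löb-valid A root     = □ᵗ-Löb (trace A)
Löb-valid A (leaf _) = refl

J3-valid : ∀ A B C → Valid (((A ▷ C) ∧' (B ▷ C)) ⊃ ((A ∨' B) ▷ C))
J3-valid A B C root     = ▷ᵗ-J3 (trace A) (trace B) (trace C)
J3-valid A B C (leaf _) = refl

J6-valid : ∀ A → Valid ((□ A) ⇔ ((¬' A) ▷ ⊥'))
J6-valid A root     = □ᵗ-J6 (trace A)
J6-valid A (leaf _) = refl

J2-valid : ∀ A B C → Valid (J2 A B C)
J2-valid A B C root     = ▷ᵗ-J2 (trace A) (trace B) (trace C)
J2-valid A B C (leaf _) = refl

J4₊-valid : ∀ A B C → Valid (J4₊ A B C)
J4₊-valid A B C root     = ▷ᵗ-J4₊ (trace A) (trace B) (trace C)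
J4₊-valid A B C (leaf _) = refl

-- J5 holds at the root since ◇A is false at every endpoint.
J5-valid : ∀ A → Valid (J5 A)
J5-valid A root     = refl
J5-valid A (leaf _) = refl

necessitation : ∀ {A} → Valid A → Valid (□ A)
necessitation valid root
  rewrite valid (leaf x) | valid (leaf y) | valid (leaf z) = refl
necessitation valid (leaf _) = refl

▷-right-rule : ∀ {A B} C → Valid (A ⊃ B) → Valid ((C ▷ A) ⊃ (C ▷ B))
▷-right-rule {A} {B} C valid u = mpᵇ (J4₊-valid A B C u) (necessitation {A ⊃ B} valid u)

▷-left-rule : ∀ {A B} C → Valid (A ⊃ B) → Valid ((B ▷ C) ⊃ (A ▷ C))
▷-left-rule {A} {B} C valid root =
  mpᵇ (▷ᵗ-antitone (trace A) (trace B) (trace C)) (necessitation {A ⊃ B} valid root)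
▷-left-rule C valid (leaf _) = refl

sound : ∀ {A} → ⊢ A → Valid A
sound (taut {A} t)    = tautology-valid {A} t
sound (axK A B)       = K-valid A B
sound (axL A)         = Löb-valid A
sound (axJ3 A B C)    = J3-valid A B C
sound (axJ6 A)        = J6-valid A
sound (axJ2 A B C)    = J2-valid A B C
sound (axJ4₊ A B C)   = J4₊-valid A B C
sound (axJ5 A)        = J5-valid A
sound (mp ⊢A⊃B ⊢A)    = λ u → mpᵇ (sound ⊢A⊃B u) (sound ⊢A u)
sound (nec ⊢A)        = necessitation (sound ⊢A)
sound (r1 C ⊢A⊃B)     = ▷-right-rule C (sound ⊢A⊃B)
sound (r2 C ⊢A⊃B)     = ▷-left-rule C (sound ⊢A⊃B)

-- The instance of J2₊ with p, q, r := variables 0, 1, 2 is false at the root: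
-- x ⊨ p but y ⊭ r, so p ▷ r fails, while p ▷ (q ∨ r) and q ▷ r hold.
J2₊-refuted : sat root (J2₊ (var 0) (var 1) (var 2)) ≡ false
J2₊-refuted = refl

proposition6p1 : ∃[ A ] ∃[ B ] ∃[ C ] ¬ (⊢ (J2₊ A B C))
proposition6p1 = var 0 , var 1 , var 2 , unprovable
  where
  unprovable : ¬ (⊢ (J2₊ (var 0) (var 1) (var 2)))
  unprovable ⊢J2₊ with trans (sym J2₊-refuted) (sound ⊢J2₊ root)
  ... | ()
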